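{- For every $n\geq2$, the map $\mathrm{code}_3$ restricted to $\tilde{\mathfrak S}_n$ is a bijection $\tilde{\mathfrak S}_n\to C_{n-2}$.
   Context: $\tilde{\mathfrak S}_n$ is the set of permutations $\sigma=\sigma_1\cdots\sigma_n$ of $[n]$ with $\sigma_1=1$. For $\sigma\in\mathfrak S_n$ and $i\in[n-2]$, $c^3_i(\sigma)$ is the number of indices $j>i+1$ such that $\sigma_i\sigma_{i+1}\sigma_j$ (standardized) is an odd permutation in $\mathfrak S_3$, and $\mathrm{code}_3(\sigma)=(c^3_1(\sigma),\dots,c^3_{n-2}(\sigma))$. $C_k$ is the set of $k$-tuples $(a_1,\dots,a_k)$ of non-negative integers with $a_i\leq k+1-i$ for all $i$. -}

module Defs where

open import Data.Nat using (ℕ; zero; suc; _+_; _<_; _≤_; _∸_; _<ᵇ_)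
open import Data.Bool using (Bool; true; false; if_then_else_; _xor_)
open import Data.Fin using (Fin; toℕ; inject₁) renaming (zero to fz; suc to fs)
open import Data.Vec using (Vec; lookup; tabulate)
import Data.List as L
open import Data.Nat.ListAction using (sum)
open import Data.Product using (Σ; _×_; ∃)
open import Relation.Binary.PropositionalEquality using (_≡_)

-- Permutations of [n], represented (0-indexed) as words σ₀ … σ_{n-1}
-- in Vec (Fin n) n whose entries are pairwise distinct.
IsPerm : {n : ℕ} → Vec (Fin n) n → Set
IsPerm {n} σ = ∀ (i j : Fin n) → lookup σ i ≡ lookup σ j → i ≡ j

-- \tilde S_n : permutations with σ₁ = 1 (0-indexed: first entry is 0).
-- Stated for n = m + 2 (so that the first entry exists).
IsTilde : {m : ℕ} → Vec (Fin (suc (suc m))) (suc (suc m)) → Set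
IsTilde σ = IsPerm σ × lookup σ fz ≡ fz

-- Parity of the standardization of a word a b c of distinct letters:
-- true iff the number of inversions is odd, i.e. the pattern is an odd
-- permutation in S₃ (132, 213, 321).
oddPattern : ℕ → ℕ → ℕ → Bool
oddPattern a b c = ((b <ᵇ a) xor (c <ᵇ a)) xor (c <ᵇ b)

pos : {m : ℕ} → Fin m → Fin (suc (suc m))
pos i = inject₁ (inject₁ i)

pos+1 : {m : ℕ} → Fin m → Fin (suc (suc m))
pos+1 i = fs (inject₁ i)

-- c³_i(σ) : number of j > i+1 with σ_i σ_{i+1} σ_j an odd pattern
-- (1-indexed i in the paper corresponds to 0-indexed i here;
--  the condition j > i+1 is index-shift invariant).
c3 : {m : ℕ} → Vec (Fin (suc (suc m))) (suc (suc m)) → Fin m → ℕ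
c3 {m} σ i =
  sum (L.map (λ j → if (suc (toℕ i) <ᵇ toℕ j)
                         then (if oddPattern (toℕ (lookup σ (pos i)))
                                             (toℕ (lookup σ (pos+1 i)))
                                             (toℕ (lookup σ j))
                               then 1 else 0)
                         else 0)
               (L.allFin (suc (suc m))))

code3 : {m : ℕ} → Vec (Fin (suc (suc m))) (suc (suc m)) → Vec ℕ m
code3 σ = tabulate (c3 σ)

-- C_k : tuples (a₁,…,a_k) with a_i ≤ k + 1 - i (1-indexed);
-- 0-indexed position t = i - 1 gives a_t ≤ k - t.
InC : {k : ℕ} → Vec ℕ k → Set
InC {k} a = ∀ (t : Fin k) → lookup a t ≤ k ∸ toℕ t

-- Write a word as a ∷ xs and code a xs for its code₃; the first digit counts
-- the letters c after a b making a b c an odd pattern (oddCount a b).  The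
-- proof rests on one observation: for fixed a, the sets {c | a b c is odd}
-- are strictly nested as b varies, and b itself is never counted.  Hence on a
-- repetition-free S avoiding a, b ↦ oddCount a b S is injective with values
-- below |S|, so by finite pigeonhole it is a bijection S → [0, |S|).  By
-- induction on the word, code a is then injective on the rearrangements of S
-- (the first digit determines the second letter) and hits every staircase
-- tuple.  The file develops, in order: finite pigeonhole and facts about
-- repetition-free lists, counting with a boolean test, odd patterns, the
-- count oddCount, the list code, and a bridge from the vector-based code3 of
-- the statement to the list code; the theorem combines the three halves.

module Submission where

open import Defs
open import Data.Nat using (ℕ; zero; suc; _<_; _≤_; _∸_; _<ᵇ_; z≤n; s≤s)
open import Data.Nat.Properties
  using (<-cmp; <-trans; <-asym; <-irrefl; <⇒≢; <⇒≤; ≮⇒≥; <-≤-trans; ≤-refl;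
         +-mono-≤; +-mono-<-≤; +-mono-≤-<; 1+n≰n; suc-injective; <ᵇ⇒<; <ᵇ-reflects-<)
open import Data.Nat.ListAction using (sum)
open import Data.Nat.ListAction.Properties using (sum-↭)
open import Data.Bool using (Bool; true; false; _xor_; if_then_else_; T)
open import Data.Bool.Properties using (xor-same)
open import Data.Fin using (Fin; toℕ; fromℕ<; punchOut) renaming (zero to fz; suc to fs)
open import Data.Fin.Properties
  using (toℕ-injective; toℕ<n; toℕ-fromℕ<; punchOut-injective; injective⇒≤; any?; _≟_)
open import Data.Vec using (Vec; []; _∷_; lookup; tabulate; toList)
open import Data.Vec.Properties using (toList-injective; cast-is-id; tabulate-cong; lookup∘tabulate)
open import Data.List as L using (List; []; _∷_; length; upTo; applyUpTo)
open import Data.List.Properties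
  using (∷-injectiveˡ; ∷-injectiveʳ; length-tabulate; map-tabulate; tabulate-lookup;
         length-applyUpTo)
open import Data.List.Membership.Propositional using (_∈_)
open import Data.List.Membership.Propositional.Properties
  using (∈-lookup; ∈-tabulate⁺; ∈-tabulate⁻; ∈-upTo⁺; ∈-upTo⁻; ∈-∃++)
open import Data.List.Membership.Propositional.Properties.WithK using (unique∧set⇒bag)
open import Data.List.Relation.Unary.All as All using (All; []; _∷_)
open import Data.List.Relation.Unary.All.Properties using (all-upTo; tabulate⁻)
open import Data.List.Relation.Unary.AllPairs using (_∷_)
open import Data.List.Relation.Unary.Any using (here; there)
open import Data.List.Relation.Unary.Unique.Propositional using (Unique; tail)
open import Data.List.Relation.Unary.Unique.Propositional.Properties
  using (upTo⁺) renaming (tabulate⁺ to Unique-tabulate⁺)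
open import Data.List.Relation.Binary.Permutation.Propositional
  using (_↭_; prep; ↭-refl; ↭-sym; ↭-trans; ↭⇒↭ₛ)
open import Data.List.Relation.Binary.Permutation.Propositional.Properties
  using (∈-resp-↭; ↭-length; drop-∷; shift; All-resp-↭; ↭-empty-inv; ↭-singleton-inv)
  renaming (map⁺ to ↭-map⁺)
open import Data.List.Relation.Binary.Permutation.Setoid.Properties as Setoid↭ using ()
open import Data.List.Relation.Binary.BagAndSetEquality using (∼bag⇒↭)
open import Data.Product using (Σ; _×_; _,_; proj₁; ∃)
open import Data.Sum using (_⊎_; inj₁; inj₂)
open import Data.Empty using (⊥-elim)
open import Data.Unit using (tt)
open import Function.Bundles using (_⇔_; mk⇔; Equivalence)
open import Function.Definitions using (Injective)
open import Relation.Nullary using (¬_; yes; no)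
open import Relation.Nullary.Reflects using (Reflects; ofʸ; ofⁿ)
open import Relation.Binary using (tri<; tri≈; tri>)
open import Relation.Binary.PropositionalEquality
  using (_≡_; _≢_; refl; sym; trans; cong; cong₂; subst; subst₂; setoid; module ≡-Reasoning)

open Equivalence using (to; from)

private
  variable
    A : Set
    M n k : ℕ

-- Finite pigeonhole: an injective endomap of Fin n is onto.  If y were
-- missed, punching y out would inject Fin n into Fin (n - 1).
injective⇒surjective : {f : Fin n → Fin n} → Injective _≡_ _≡_ f →
                       ∀ y → ∃ λ x → f x ≡ y
injective⇒surjective {n = suc n} {f = f} f-inj y with any? (λ x → f x ≟ y)
... | yes hit = hit
... | no miss = ⊥-elim (1+n≰n (injective⇒≤ squeezed-injective))
  where
  squeezed : Fin (suc n) → Fin n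
  squeezed x = punchOut {i = y} (λ y≡fx → miss (x , sym y≡fx))
  squeezed-injective : Injective _≡_ _≡_ squeezed
  squeezed-injective e = f-inj (punchOut-injective {i = y} _ _ e)

Unique-tabulate⁻ : {f : Fin n → A} → Unique (L.tabulate f) → Injective _≡_ _≡_ f
Unique-tabulate⁻ {n = suc n} (_ ∷ _) {fz} {fz} _ = refl
Unique-tabulate⁻ {n = suc n} (f0∉ ∷ _) {fz} {fs j} e = ⊥-elim (tabulate⁻ f0∉ j e)
Unique-tabulate⁻ {n = suc n} (f0∉ ∷ _) {fs i} {fz} e = ⊥-elim (tabulate⁻ f0∉ i (sym e))
Unique-tabulate⁻ {n = suc n} (_ ∷ u) {fs i} {fs j} e = cong fs (Unique-tabulate⁻ u e)

Unique-lookup-injective : {xs : List A} → Unique xs → Injective _≡_ _≡_ (L.lookup xs)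
Unique-lookup-injective {xs = xs} u =
  Unique-tabulate⁻ (subst Unique (sym (tabulate-lookup xs)) u)

Unique-resp-↭ : {xs ys : List A} → xs ↭ ys → Unique xs → Unique ys
Unique-resp-↭ {A = A} p = Setoid↭.Unique-resp-↭ (setoid A) (↭⇒↭ₛ p)

Unique-sameMembers⇒↭ : {xs ys : List A} → Unique xs → Unique ys →
                       (∀ {z} → z ∈ xs → z ∈ ys) → (∀ {z} → z ∈ ys → z ∈ xs) → xs ↭ ys
Unique-sameMembers⇒↭ ux uy xs⊆ys ys⊆xs = ∼bag⇒↭ (unique∧set⇒bag ux uy (mk⇔ xs⊆ys ys⊆xs))

∈⇒↭-front : {x : A} {xs : List A} → x ∈ xs → ∃ λ rest → xs ↭ x ∷ rest
∈⇒↭-front {x = x} x∈xs with l , r , refl ← ∈-∃++ x∈xs = l L.++ r , shift x l r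

indicator : Bool → ℕ
indicator b = if b then 1 else 0

count : (A → Bool) → List A → ℕ
count p xs = sum (L.map (λ c → indicator (p c)) xs)

count-↭ : (p : A → Bool) {xs ys : List A} → xs ↭ ys → count p xs ≡ count p ys
count-↭ p xs↭ys = sum-↭ (↭-map⁺ _ xs↭ys)

count-true : (xs : List A) → count (λ _ → true) xs ≡ length xs
count-true [] = refl
count-true (_ ∷ xs) = cong suc (count-true xs)

indicator-mono : ∀ x y → (T x → T y) → indicator x ≤ indicator y
indicator-mono false _ _ = z≤n
indicator-mono true true _ = ≤-refl
indicator-mono true false x⇒y = ⊥-elim (x⇒y tt)

indicator-strict : ∀ x y → ¬ T x → T y → indicator x < indicator y
indicator-strict false true _ _ = s≤s z≤n
indicator-strict true _ ¬x _ = ⊥-elim (¬x tt)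

count-mono : {p q : A → Bool} → (∀ c → T (p c) → T (q c)) → ∀ xs → count p xs ≤ count q xs
count-mono p⇒q [] = z≤n
count-mono {p = p} {q} p⇒q (c ∷ xs) =
  +-mono-≤ (indicator-mono (p c) (q c) (p⇒q c)) (count-mono p⇒q xs)

count-strict : {p q : A → Bool} → (∀ c → T (p c) → T (q c)) →
               ∀ {x xs} → x ∈ xs → ¬ T (p x) → T (q x) → count p xs < count q xs
count-strict {p = p} {q} p⇒q {x} {.x ∷ xs} (here refl) ¬px qx =
  +-mono-<-≤ (indicator-strict (p x) (q x) ¬px qx) (count-mono p⇒q xs)
count-strict {p = p} {q} p⇒q {xs = c ∷ _} (there x∈) ¬px qx =
  +-mono-≤-< (indicator-mono (p c) (q c) (p⇒q c)) (count-strict p⇒q x∈ ¬px qx)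

count-≤-length : (p : A → Bool) (xs : List A) → count p xs ≤ length xs
count-≤-length p xs = subst (count p xs ≤_) (count-true xs) (count-mono (λ _ _ → tt) xs)

count-<-length : (p : A → Bool) {x : A} {xs : List A} → x ∈ xs → ¬ T (p x) → count p xs < length xs
count-<-length p {xs = xs} x∈ ¬px =
  subst (count p xs <_) (count-true xs) (count-strict (λ _ _ → tt) x∈ ¬px tt)

oddPattern-self : ∀ a b → ¬ T (oddPattern a b b)
oddPattern-self a b t =
  <-irrefl refl (<ᵇ⇒< b b (subst (λ x → T (x xor (b <ᵇ b))) (xor-same (b <ᵇ a)) t))

oddPattern-ascent : ∀ {a b c} → a < b → T (oddPattern a b c) ⇔ (a ≤ c × c < b)
oddPattern-ascent {a} {b} {c} a<b =
  table (<ᵇ-reflects-< b a) (<ᵇ-reflects-< c a) (<ᵇ-reflects-< c b)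
  where
  table : ∀ {x y z} → Reflects (b < a) x → Reflects (c < a) y → Reflects (c < b) z →
          T ((x xor y) xor z) ⇔ (a ≤ c × c < b)
  table (ofʸ b<a) _ _ = ⊥-elim (<-asym a<b b<a)
  table (ofⁿ _) (ofʸ c<a) (ofʸ _) = mk⇔ ⊥-elim (λ (a≤c , _) → <-irrefl refl (<-≤-trans c<a a≤c))
  table (ofⁿ _) (ofʸ c<a) (ofⁿ c≮b) = ⊥-elim (c≮b (<-trans c<a a<b))
  table (ofⁿ _) (ofⁿ c≮a) (ofʸ c<b) = mk⇔ (λ _ → ≮⇒≥ c≮a , c<b) (λ _ → tt)
  table (ofⁿ _) (ofⁿ _) (ofⁿ c≮b) = mk⇔ ⊥-elim (λ (_ , c<b) → c≮b c<b)

oddPattern-descent : ∀ {a b c} → b < a → T (oddPattern a b c) ⇔ (c < b ⊎ a ≤ c)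
oddPattern-descent {a} {b} {c} b<a =
  table (<ᵇ-reflects-< b a) (<ᵇ-reflects-< c a) (<ᵇ-reflects-< c b)
  where
  table : ∀ {x y z} → Reflects (b < a) x → Reflects (c < a) y → Reflects (c < b) z →
          T ((x xor y) xor z) ⇔ (c < b ⊎ a ≤ c)
  table (ofⁿ b≮a) _ _ = ⊥-elim (b≮a b<a)
  table (ofʸ _) (ofʸ _) (ofʸ c<b) = mk⇔ (λ _ → inj₁ c<b) (λ _ → tt)
  table (ofʸ _) (ofʸ c<a) (ofⁿ c≮b) =
    mk⇔ ⊥-elim λ { (inj₁ c<b) → c≮b c<b ; (inj₂ a≤c) → <-irrefl refl (<-≤-trans c<a a≤c) }
  table (ofʸ _) (ofⁿ c≮a) (ofʸ c<b) = ⊥-elim (c≮a (<-trans c<b b<a))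
  table (ofʸ _) (ofⁿ c≮a) (ofⁿ _) = mk⇔ (λ _ → inj₂ (≮⇒≥ c≮a)) (λ _ → tt)

OddBelow : ℕ → ℕ → ℕ → Set
OddBelow a b b′ = ∀ c → T (oddPattern a b c) → T (oddPattern a b′ c)

oddPattern-nested : ∀ {a b b′} → a ≢ b → a ≢ b′ → b < b′ →
  (OddBelow a b b′ × T (oddPattern a b′ b)) ⊎ (OddBelow a b′ b × T (oddPattern a b b′))
oddPattern-nested {a} {b} {b′} a≢b a≢b′ b<b′ with <-cmp a b
... | tri≈ _ a≡b _ = ⊥-elim (a≢b a≡b)
... | tri< a<b _ _ =
  inj₁ ( (λ c t → let (a≤c , c<b) = to (oddPattern-ascent a<b) t
                  in from (oddPattern-ascent a<b′) (a≤c , <-trans c<b b<b′))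
       , from (oddPattern-ascent a<b′) (<⇒≤ a<b , b<b′))
  where
  a<b′ = <-trans a<b b<b′
... | tri> _ _ b<a with <-cmp a b′
...   | tri≈ _ a≡b′ _ = ⊥-elim (a≢b′ a≡b′)
...   | tri< a<b′ _ _ =
  inj₂ ( (λ c t → from (oddPattern-descent b<a) (inj₂ (proj₁ (to (oddPattern-ascent a<b′) t))))
       , from (oddPattern-descent b<a) (inj₂ (<⇒≤ a<b′)))
...   | tri> _ _ b′<a =
  inj₁ ( (λ c t → from (oddPattern-descent b′<a) (widen (to (oddPattern-descent b<a) t)))
       , from (oddPattern-descent b′<a) (inj₁ b<b′))
  where
  widen : ∀ {c} → c < b ⊎ a ≤ c → c < b′ ⊎ a ≤ c
  widen (inj₁ c<b) = inj₁ (<-trans c<b b<b′)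
  widen (inj₂ a≤c) = inj₂ a≤c

-- oddCount a b S: the number of letters c of S for which a b c is odd; the
-- first digit of code₃ of a b followed by S.
oddCount : ℕ → ℕ → List ℕ → ℕ
oddCount a b = count (oddPattern a b)

oddCount-↭ : ∀ a b {xs ys} → xs ↭ ys → oddCount a b xs ≡ oddCount a b ys
oddCount-↭ a b = count-↭ (oddPattern a b)

oddCount-skip : ∀ a b xs → oddCount a b (b ∷ xs) ≡ oddCount a b xs
oddCount-skip a b xs with oddPattern a b b in ab-odd
... | false = refl
... | true = ⊥-elim (oddPattern-self a b (subst T (sym ab-odd) tt))

oddCount-<-length : ∀ a {b S} → b ∈ S → oddCount a b S < length S
oddCount-<-length a {b} b∈S = count-<-length (oddPattern a b) b∈S (oddPattern-self a b)

-- For letters b < b′ of S other than a the counts differ: by the nesting of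
-- odd sets, the smaller count misses a letter of S that the larger one has.
oddCount-differ : ∀ {a b b′ S} → b ∈ S → b′ ∈ S → a ≢ b → a ≢ b′ → b < b′ →
                  oddCount a b S ≢ oddCount a b′ S
oddCount-differ {a} {b} {b′} b∈S b′∈S a≢b a≢b′ b<b′ same with oddPattern-nested a≢b a≢b′ b<b′
... | inj₁ (b⊆b′ , odd) = <⇒≢ (count-strict b⊆b′ b∈S (oddPattern-self a b) odd) same
... | inj₂ (b′⊆b , odd) = <⇒≢ (count-strict b′⊆b b′∈S (oddPattern-self a b′) odd) (sym same)

oddCount-separates : ∀ {a b b′ S} → b ∈ S → b′ ∈ S → a ≢ b → a ≢ b′ →
                     oddCount a b S ≡ oddCount a b′ S → b ≡ b′
oddCount-separates {b = b} {b′} b∈S b′∈S a≢b a≢b′ same with <-cmp b b′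
... | tri< b<b′ _ _ = ⊥-elim (oddCount-differ b∈S b′∈S a≢b a≢b′ b<b′ same)
... | tri≈ _ b≡b′ _ = b≡b′
... | tri> _ _ b′<b = ⊥-elim (oddCount-differ b′∈S b∈S a≢b′ a≢b b′<b (sym same))

-- Every d < |S| is the count of some letter b of S (when a ∉ S and S has no
-- repetitions): b ↦ oddCount a b S is injective on S with values below |S|,
-- so by finite pigeonhole on the positions of S it hits every such d.
oddCount-onto : ∀ a S → Unique (a ∷ S) → ∀ {d} → d < length S →
                ∃ λ b → b ∈ S × oddCount a b S ≡ d
oddCount-onto a S (a∉S ∷ uS) {d} d<|S| =
  let i , digit-i≡d = injective⇒surjective digit-injective (fromℕ< d<|S|)
  in L.lookup S i , ∈-lookup i , trans (sym (digit-value i)) (trans (cong toℕ digit-i≡d) (toℕ-fromℕ< d<|S|))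
  where
  digit : Fin (length S) → Fin (length S)
  digit i = fromℕ< (oddCount-<-length a (∈-lookup {xs = S} i))
  digit-value : ∀ i → toℕ (digit i) ≡ oddCount a (L.lookup S i) S
  digit-value i = toℕ-fromℕ< _
  digit-injective : Injective _≡_ _≡_ digit
  digit-injective {i} {j} e =
    Unique-lookup-injective uS
      (oddCount-separates {S = S} (∈-lookup i) (∈-lookup j)
        (All.lookup a∉S (∈-lookup i)) (All.lookup a∉S (∈-lookup j))
        (trans (sym (digit-value i)) (trans (cong toℕ e) (digit-value j))))

-- code a xs is code₃ of the word a ∷ xs.
code : ℕ → List ℕ → List ℕ
code a [] = []
code a (b ∷ []) = []
code a (b ∷ c ∷ r) = oddCount a b (c ∷ r) ∷ code b (c ∷ r)

code-∷ : ∀ a b ys → length ys ≡ suc k → code a (b ∷ ys) ≡ oddCount a b ys ∷ code b ys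
code-∷ a b (c ∷ r) _ = refl

-- Among rearrangements of a set of distinct letters avoiding a, the code
-- determines the word: its first digit singles out the second letter.
code-injective : ∀ a xs ys → Unique (a ∷ xs) → xs ↭ ys → code a xs ≡ code a ys → xs ≡ ys
code-injective a [] ys _ xs↭ys _ = sym (↭-empty-inv (↭-sym xs↭ys))
code-injective a (b ∷ []) ys _ xs↭ys _ = sym (↭-singleton-inv (↭-sym xs↭ys))
code-injective a (b ∷ c ∷ r) [] _ xs↭ys _ with () ← ↭-length xs↭ys
code-injective a (b ∷ c ∷ r) (b′ ∷ []) _ xs↭ys _ with () ← ↭-length xs↭ys
code-injective a (b ∷ c ∷ r) (b′ ∷ c′ ∷ r′) ((a≢b ∷ a∉) ∷ u) xs↭ys same
  with oddCount-separates (here refl) b′∈S a≢b (All.lookup (a≢b ∷ a∉) b′∈S) first-digits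
  where
  S = b ∷ c ∷ r
  b′∈S : b′ ∈ S
  b′∈S = ∈-resp-↭ (↭-sym xs↭ys) (here refl)
  first-digits : oddCount a b S ≡ oddCount a b′ S
  first-digits = begin
    oddCount a b S                 ≡⟨ oddCount-skip a b (c ∷ r) ⟩
    oddCount a b (c ∷ r)           ≡⟨ ∷-injectiveˡ same ⟩
    oddCount a b′ (c′ ∷ r′)        ≡⟨ oddCount-skip a b′ (c′ ∷ r′) ⟨
    oddCount a b′ (b′ ∷ c′ ∷ r′)   ≡⟨ oddCount-↭ a b′ xs↭ys ⟨
    oddCount a b′ S                ∎
    where open ≡-Reasoning
... | refl = cong (b ∷_) (code-injective b (c ∷ r) (c′ ∷ r′) u (drop-∷ xs↭ys) (∷-injectiveʳ same))

-- Every staircase tuple is the code of some arrangement of S: choose the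
-- second letter by its first digit (oddCount-onto) and recurse on the rest.
code-onto : ∀ a S → Unique (a ∷ S) → length S ≡ suc k → (ds : Vec ℕ k) → InC ds →
            ∃ λ ys → ys ↭ S × code a ys ≡ toList ds
code-onto a (s ∷ []) _ _ [] _ = s ∷ [] , ↭-refl , refl
code-onto {suc k} a S u |S| (d ∷ ds) inC
  with b , b∈S , b-digit ← oddCount-onto a S u (subst (d <_) (sym |S|) (s≤s (inC fz)))
  with S′ , S↭bS′ ← ∈⇒↭-front b∈S
  with |S′| ← suc-injective (trans (sym (↭-length S↭bS′)) |S|)
  with ys , ys↭S′ , ys-code ← code-onto b S′ (tail (Unique-resp-↭ (prep a S↭bS′) u)) |S′|
                                         ds (λ t → inC (fs t))
  = b ∷ ys , bys↭S , codes
  where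
  bys↭S : b ∷ ys ↭ S
  bys↭S = ↭-trans (prep b ys↭S′) (↭-sym S↭bS′)
  open ≡-Reasoning
  first-digit : oddCount a b ys ≡ d
  first-digit = begin
    oddCount a b ys         ≡⟨ oddCount-skip a b ys ⟨
    oddCount a b (b ∷ ys)   ≡⟨ oddCount-↭ a b bys↭S ⟩
    oddCount a b S          ≡⟨ b-digit ⟩
    d                       ∎
  codes : code a (b ∷ ys) ≡ d ∷ toList ds
  codes = begin
    code a (b ∷ ys)              ≡⟨ code-∷ a b ys (trans (↭-length ys↭S′) |S′|) ⟩
    oddCount a b ys ∷ code b ys  ≡⟨ cong₂ _∷_ first-digit ys-code ⟩
    d ∷ toList ds                ∎

entries : Vec (Fin M) n → List ℕ
entries w = L.tabulate (λ i → toℕ (lookup w i))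

entries-length : (w : Vec (Fin M) n) → length (entries w) ≡ n
entries-length w = length-tabulate _

entries-injective : (v w : Vec (Fin M) n) → entries v ≡ entries w → v ≡ w
entries-injective [] [] _ = refl
entries-injective (x ∷ v) (y ∷ w) same =
  cong₂ _∷_ (toℕ-injective (∷-injectiveˡ same)) (entries-injective v w (∷-injectiveʳ same))

distinct⇒Unique : (w : Vec (Fin M) n) → (∀ i j → lookup w i ≡ lookup w j → i ≡ j) → Unique (entries w)
distinct⇒Unique w distinct = Unique-tabulate⁺ (λ e → distinct _ _ (toℕ-injective e))

Unique⇒distinct : (w : Vec (Fin M) n) → Unique (entries w) → ∀ i j → lookup w i ≡ lookup w j → i ≡ j
Unique⇒distinct w u i j e = Unique-tabulate⁻ u (cong toℕ e)

-- The letters of a permutation of [M] are a rearrangement of 0, …, M-1;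
-- that every letter occurs is finite pigeonhole.
permutation-entries : (σ : Vec (Fin M) M) → IsPerm σ → entries σ ↭ upTo M
permutation-entries {M} σ perm =
  Unique-sameMembers⇒↭ (distinct⇒Unique σ perm) (upTo⁺ M) occurs-below occurs
  where
  occurs-below : ∀ {z} → z ∈ entries σ → z ∈ upTo M
  occurs-below z∈ with i , refl ← ∈-tabulate⁻ z∈ = ∈-upTo⁺ (toℕ<n (lookup σ i))
  occurs : ∀ {z} → z ∈ upTo M → z ∈ entries σ
  occurs {z} z∈ with i , σi≡z ← injective⇒surjective (perm _ _) (fromℕ< (∈-upTo⁻ z∈)) =
    subst (_∈ entries σ) (trans (cong toℕ σi≡z) (toℕ-fromℕ< _)) (∈-tabulate⁺ i)

bounded⇒entries : ∀ n (ys : List ℕ) → length ys ≡ n → All (_< M) ys →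
                  ∃ λ (w : Vec (Fin M) n) → entries w ≡ ys
bounded⇒entries zero [] _ [] = [] , refl
bounded⇒entries (suc n) (y ∷ ys) |ys| (y<M ∷ ys<M)
  with w , w≡ys ← bounded⇒entries n ys (suc-injective |ys|) ys<M =
  fromℕ< y<M ∷ w , cong₂ _∷_ (toℕ-fromℕ< y<M) w≡ys

-- c³_i of an arbitrary word over the alphabet Fin M (Defs's c3 is the case
-- where M is the length of the word): the sum over positions j of
-- c3′-term w i j, which is 1 iff j > i + 1 and w_i w_{i+1} w_j is odd.
-- The body is Defs's, so code3 σ is definitionally tabulate (c3′ σ).
c3′-term : Vec (Fin M) (suc (suc k)) → Fin k → Fin (suc (suc k)) → ℕ
c3′-term w i j =
  if (suc (toℕ i) <ᵇ toℕ j)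
  then (if oddPattern (toℕ (lookup w (pos i))) (toℕ (lookup w (pos+1 i))) (toℕ (lookup w j))
        then 1 else 0)
  else 0

c3′ : Vec (Fin M) (suc (suc k)) → Fin k → ℕ
c3′ {k = k} w i = sum (L.map (c3′-term w i) (L.allFin (suc (suc k))))

c3′-suc : (x : Fin M) (w : Vec (Fin M) (suc (suc k))) (i : Fin k) → c3′ (x ∷ w) (fs i) ≡ c3′ w i
c3′-suc x w i =
  cong sum (trans (map-tabulate fs (c3′-term (x ∷ w) (fs i))) (sym (map-tabulate (λ j → j) (c3′-term w i))))

c3′-zero : (x y : Fin M) (w : Vec (Fin M) (suc k)) →
           c3′ (x ∷ y ∷ w) fz ≡ oddCount (toℕ x) (toℕ y) (entries w)
c3′-zero x y w =
  cong sum (trans (map-tabulate (λ j → fs (fs j)) (c3′-term (x ∷ y ∷ w) fz))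
                  (sym (map-tabulate (λ j → toℕ (lookup w j)) (λ c → indicator (oddPattern (toℕ x) (toℕ y) c)))))

c3′-code : (x : Fin M) (w : Vec (Fin M) (suc k)) → toList (tabulate (c3′ (x ∷ w))) ≡ code (toℕ x) (entries w)
c3′-code {k = zero} x (y ∷ []) = refl
c3′-code {k = suc k} x (y ∷ z ∷ w) =
  cong₂ _∷_ (c3′-zero x y (z ∷ w))
            (trans (cong toList (tabulate-cong (c3′-suc x (y ∷ z ∷ w)))) (c3′-code y (z ∷ w)))

-- c³_i counts letters among the n - i - 1 after position i + 1.
c3′-bound : (w : Vec (Fin M) (suc (suc k))) (i : Fin k) → c3′ w i ≤ k ∸ toℕ i
c3′-bound (x ∷ y ∷ w) fz =
  subst₂ _≤_ (sym (c3′-zero x y w)) (entries-length w) (count-≤-length _ (entries w))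
c3′-bound (x ∷ w) (fs i) = subst (_≤ _) (sym (c3′-suc x w i)) (c3′-bound w i)

code3-InC : ∀ {m} (σ : Vec (Fin (suc (suc m))) (suc (suc m))) → InC (code3 σ)
code3-InC σ t = subst (_≤ _) (sym (lookup∘tabulate (c3′ σ) t)) (c3′-bound σ t)

-- code₃ is injective on \tilde S_n: both tails are arrangements of 1, …, n-1.
code3-injective : ∀ {m} (σ τ : Vec (Fin (suc (suc m))) (suc (suc m))) → IsTilde σ → IsTilde τ →
                  code3 σ ≡ code3 τ → σ ≡ τ
code3-injective (fz ∷ σ) (fz ∷ τ) (σ-perm , refl) (τ-perm , refl) same =
  cong (fz ∷_) (entries-injective σ τ
    (code-injective 0 (entries σ) (entries τ) (distinct⇒Unique (fz ∷ σ) σ-perm) tails codes))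
  where
  tails : entries σ ↭ entries τ
  tails = drop-∷ (↭-trans (permutation-entries (fz ∷ σ) σ-perm)
                          (↭-sym (permutation-entries (fz ∷ τ) τ-perm)))
  codes : code 0 (entries σ) ≡ code 0 (entries τ)
  codes = trans (sym (c3′-code fz σ)) (trans (cong toList same) (c3′-code fz τ))

-- code₃ maps \tilde S_n onto C_{n-2}: arrange the letters 1, …, m+1 (the list
-- applyUpTo suc (m+1), so that upTo (m+2) is 0 followed by it) after 0.
code3-onto : ∀ {m} (a : Vec ℕ m) → InC a →
             Σ (Vec (Fin (suc (suc m))) (suc (suc m))) (λ σ → IsTilde σ × code3 σ ≡ a)
code3-onto {m} a a∈C
  with ys , ys↭S , ys-code ← code-onto 0 (applyUpTo suc (suc m)) (upTo⁺ (suc (suc m))) (length-applyUpTo suc (suc m)) a a∈C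
  with σ , σ≡ys ← bounded⇒entries (suc m) ys (trans (↭-length ys↭S) (length-applyUpTo suc (suc m)))
                                  (All-resp-↭ (↭-sym ys↭S) (All.tail (all-upTo (suc (suc m)))))
  = fz ∷ σ , (perm , refl) , codes
  where
  perm : IsPerm (fz ∷ σ)
  perm = Unique⇒distinct (fz ∷ σ)
           (subst (λ zs → Unique (0 ∷ zs)) (sym σ≡ys) (Unique-resp-↭ (prep 0 (↭-sym ys↭S)) (upTo⁺ (suc (suc m)))))
  codes : code3 (fz ∷ σ) ≡ a
  codes = trans (sym (cast-is-id refl _))
                (toList-injective refl _ a (trans (c3′-code fz σ) (trans (cong (code 0) σ≡ys) ys-code)))

proposition3p2 : (m : ℕ) →
    ((σ : Vec (Fin (suc (suc m))) (suc (suc m))) → IsTilde σ → InC (code3 σ))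
    × ((σ τ : Vec (Fin (suc (suc m))) (suc (suc m))) → IsTilde σ → IsTilde τ →
         code3 σ ≡ code3 τ → σ ≡ τ)
    × ((a : Vec ℕ m) → InC a →
         Σ (Vec (Fin (suc (suc m))) (suc (suc m))) (λ σ → IsTilde σ × code3 σ ≡ a))
proposition3p2 m = (λ σ _ → code3-InC σ) , code3-injective , code3-onto
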